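{- Let $G_1$ and $G_2$ be finite $(2k+1)$-regular graphs such that $G_1$ has a semi-coloring and $G_2$ is of class 1. Then $G_1$ and $G_2$ have a tight product.
   Context: All graphs are finite, undirected, and may have multiple edges and loops. Degrees count multiple edges with multiplicity, and a loop contributes $2$ to the degree of its vertex; the neighbor set $N_G(v)$ is a multiset. A map $\phi:V(H)\to V(G)$ is a covering map if for every $v\in V(H)$, $\phi$ maps the multiset $N_H(v)$ one-to-one and onto the multiset $N_G(\phi(v))$. A graph $H$ is a tight product of $G_1$ and $G_2$ if $V(H)=V(G_1)\times V(G_2)$ and both coordinate projections are covering maps. A graph is of class 1 if its edge-chromatic number equals its maximum degree. For a graph $G=(V,E)$ with maximum degree $\Delta$, a semi-coloring is a coloring of $E$ with color set $[\Delta]\cup\binom{[\Delta]}{2}$ (each edge gets either an element $i\in[\Delta]$, of weight $1$ for $i$, or an unordered pair $\{i,j\}$, regarded as "half $i$ and half $j$", contributing weight $1/2$ to each of $i$ and $j$) such that for every vertex $v$: (a) for every $i\in[\Delta]$ the total weight of $i$ on the edges incident with $v$ is at most $1$; (b) for every $i\neq j$ in $[\Delta]$ there are either $0$ or $2$ edges colored $\{i,j\}$ incident with $v$. -}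

module Defs where

open import Data.Nat using (ℕ; zero; suc; _+_; _*_; _≤_; _<_; _⊔_)
open import Data.Fin as Fin using (Fin; toℕ)
open import Data.Fin.Properties using () renaming (_≟_ to _≟ᶠ_)
open import Data.List using (List; []; _∷_; _++_; map; concatMap; foldr; length)
open import Data.Nat.ListAction using (sum)
open import Data.List.Relation.Binary.Permutation.Propositional using (_↭_)
open import Data.List.Relation.Unary.Unique.Propositional using (Unique)
open import Data.Product using (Σ; _×_; _,_; proj₁; proj₂)
open import Data.Product.Properties using (≡-dec)
open import Data.Sum using (_⊎_; inj₁; inj₂)
open import Relation.Binary.PropositionalEquality using (_≡_)
open import Relation.Binary.Definitions using (DecidableEquality)
open import Relation.Nullary using (¬_; yes; no)

-- A finite multigraph (loops and multiple edges allowed) on vertex type V: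
-- m edges, each edge e has an (unordered, stored as a pair) set of endpoints.
record Graph (V : Set) : Set where
  field
    m    : ℕ
    ends : Fin m → V × V
open Graph public

module _ {V : Set} (_≟_ : DecidableEquality V) (G : Graph V) where

  -- edge-incidences at v: e appears once per endpoint equal to v
  -- (a loop at v appears twice)
  incid : V → List (Fin (m G))
  incid v = concatMap f (Data.List.allFin (m G))
    where
    open import Data.List using (allFin)
    f : Fin (m G) → List (Fin (m G))
    f e with proj₁ (ends G e) ≟ v | proj₂ (ends G e) ≟ v
    ... | yes _ | yes _ = e ∷ e ∷ []
    ... | yes _ | no _  = e ∷ []
    ... | no _  | yes _ = e ∷ []
    ... | no _  | no _  = []

  nbrs : V → List V
  nbrs v = concatMap f (Data.List.allFin (m G))
    where
    f : Fin (m G) → List V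
    f e with ends G e
    ... | (a , b) with a ≟ v | b ≟ v
    ...   | yes _ | yes _ = b ∷ a ∷ []
    ...   | yes _ | no _  = b ∷ []
    ...   | no _  | yes _ = a ∷ []
    ...   | no _  | no _  = []

  degree : V → ℕ
  degree v = length (incid v)

FGraph : ℕ → Set
FGraph n = Graph (Fin n)

module _ {n : ℕ} (G : FGraph n) where

  deg : Fin n → ℕ
  deg = degree _≟ᶠ_ G

  maxDegree : ℕ
  maxDegree = foldr _⊔_ 0 (map deg (Data.List.allFin n))

  Regular : ℕ → Set
  Regular d = ∀ v → deg v ≡ d

  -- proper edge colouring with k colours: at every vertex the colours of the
  -- incident edge-ends are pairwise distinct (so loops are never properly coloured)
  ProperEdgeColouring : (k : ℕ) → (Fin (m G) → Fin k) → Set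
  ProperEdgeColouring k c = ∀ v → Unique (map c (incid _≟ᶠ_ G v))

  EdgeColourable : ℕ → Set
  EdgeColourable k = Σ (Fin (m G) → Fin k) (ProperEdgeColouring k)

  Class1 : Set
  Class1 = EdgeColourable maxDegree × (∀ k → k < maxDegree → ¬ EdgeColourable k)

  -- semi-colouring colours: an element of [Δ] or an unordered pair {i,j}, i ≠ j,
  -- represented as (i , j) with i < j
  SemiColour : ℕ → Set
  SemiColour Δ = Fin Δ ⊎ Σ (Fin Δ × Fin Δ) (λ p → proj₁ p Fin.< proj₂ p)

  -- twice the weight of colour i carried by a semi-colour
  weight2 : ∀ {Δ} → Fin Δ → SemiColour Δ → ℕ
  weight2 i (inj₁ j) with i ≟ᶠ j
  ... | yes _ = 2
  ... | no _  = 0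
  weight2 i (inj₂ ((a , b) , _)) with i ≟ᶠ a | i ≟ᶠ b
  ... | yes _ | _     = 1
  ... | no _  | yes _ = 1
  ... | no _  | no _  = 0

  isPair : ∀ {Δ} → Fin Δ → Fin Δ → SemiColour Δ → ℕ
  isPair i j (inj₁ _) = 0
  isPair i j (inj₂ ((a , b) , _)) with i ≟ᶠ a | j ≟ᶠ b
  ... | yes _ | yes _ = 1
  ... | _     | _     = 0

  IsSemiColouring : (Fin (m G) → SemiColour maxDegree) → Set
  IsSemiColouring c =
    ∀ v →
      -- (a) total weight of i at v is at most 1 (weights doubled)
      (∀ (i : Fin maxDegree) → sum (map (λ e → weight2 i (c e)) (incid _≟ᶠ_ G v)) ≤ 2)
      ×
      (∀ (i j : Fin maxDegree) → i Fin.< j →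
         let t = sum (map (λ e → isPair i j (c e)) (incid _≟ᶠ_ G v)) in
         (t ≡ 0) ⊎ (t ≡ 2))

  HasSemiColouring : Set
  HasSemiColouring = Σ (Fin (m G) → SemiColour maxDegree) IsSemiColouring

IsCovering : {W V : Set} (_≟W_ : DecidableEquality W) (_≟V_ : DecidableEquality V)
             (H : Graph W) (G : Graph V) (φ : W → V) → Set
IsCovering _≟W_ _≟V_ H G φ = ∀ w → map φ (nbrs _≟W_ H w) ↭ nbrs _≟V_ G (φ w)

TightProduct : {n₁ n₂ : ℕ} → FGraph n₁ → FGraph n₂ → Set
TightProduct {n₁} {n₂} G₁ G₂ =
  Σ (Graph (Fin n₁ × Fin n₂)) λ H →
    IsCovering (≡-dec _≟ᶠ_ _≟ᶠ_) _≟ᶠ_ H G₁ proj₁ ×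
    IsCovering (≡-dec _≟ᶠ_ _≟ᶠ_) _≟ᶠ_ H G₂ proj₂

-- The darts of H at a vertex (u, x) are the compatible pairs of a dart of G₁ at u and a dart
-- of G₂ at x: a G₁-dart coloured i goes with the G₂-dart coloured i, and a G₁-dart coloured {i, j}
-- with the G₂-dart coloured i or j that is oriented like it. The orientations exist because the
-- {i, j}-coloured edges form 2-factors on both sides (by condition (b), resp. since G₂ is class 1),
-- and a 2-factor can be oriented so that each vertex has one dart of it going in and one going out:
-- its darts are 2-coloured by reversal together with the pairing at the vertices, and a union of
-- two perfect matchings is bipartite. Every G₁-dart at u then has exactly one compatible G₂-dart at
-- x, so the first projection is a covering. Two G₁-darts at u never share a G₂-dart, as that would
-- put weight more than 1 of its colour on u; both graphs being d-regular, the second projection is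
-- then a covering by counting.

module Submission where

open import Defs
open import Data.Bool using (Bool; true; false; not)
open import Data.Bool.Properties using (not-¬; ¬-not; not-injective; not-involutive)
  renaming (_≟_ to _≟ᵇ_)
open import Data.Empty using (⊥; ⊥-elim)
open import Data.Maybe using (Maybe; just; nothing)
open import Data.Maybe.Properties using (just-injective)
open import Data.Fin as Fin using (Fin; toℕ)
open import Data.Fin.Properties using (toℕ<n; toℕ-injective; toℕ-fromℕ<)
open import Data.List
  using ( List; []; _∷_; _++_; map; foldr; filter; length; lookup; concatMap; allFin
        ; cartesianProduct; upTo; tabulate)
open import Data.List.Membership.Propositional using (_∈_)
open import Data.List.Membership.Propositional.Properties
  using (∈-∃++; ∈-filter⁺; ∈-filter⁻; ∈-map⁺; ∈-map⁻; ∈-lookup; ∈-allFin; ∈-cartesianProduct⁺; ∈-upTo⁺)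
open import Data.List.Membership.Propositional.Properties.WithK using (unique∧set⇒bag)
open import Data.List.Properties
  using (filter-notAll; filter-++; map-++; map-∘; map-cong; concatMap-cong; length-map; length-upTo)
open import Data.List.Relation.Binary.BagAndSetEquality using (∼bag⇒↭)
open import Data.List.Relation.Binary.Permutation.Propositional using (_↭_; ↭-sym)
import Data.List.Relation.Binary.Permutation.Propositional.Properties as ↭
open import Data.List.Relation.Binary.Subset.Propositional using (_⊆_)
open import Data.List.Relation.Unary.All using ([]; _∷_)
import Data.List.Relation.Unary.All as All
open import Data.List.Relation.Unary.All.Properties using (All¬⇒¬Any; ¬Any⇒All¬)
open import Data.List.Relation.Unary.AllPairs using ([]; _∷_)
open import Data.List.Relation.Unary.Any using (here; there; index)
import Data.List.Relation.Unary.Any as Any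
open import Data.List.Relation.Unary.Any.Properties using (lookup-index)
open import Data.List.Relation.Unary.Unique.Propositional using (Unique)
open import Data.List.Relation.Unary.Unique.Propositional.Properties
  using (allFin⁺; cartesianProduct⁺; filter⁺)
open import Data.Nat using (ℕ; zero; suc; _+_; _*_; _⊔_; _≤_; _<_; z≤n; s≤s)
open import Data.Nat.Induction using (<-wellFounded)
open import Data.Nat.ListAction using (sum)
open import Data.Nat.ListAction.Properties using (sum-↭)
open import Data.Nat.Properties
  using ( ≤-trans; ≤-reflexive; <⇒≱; <-irrefl; _<?_; +-mono-≤; +-monoʳ-≤; +-cancelˡ-<; +-identityʳ
        ; ⊔-idem; ⊔-identityʳ; module ≤-Reasoning)
  renaming (_≟_ to _≟ℕ_)
open import Data.Product using (Σ; ∃-syntax; _×_; _,_; proj₁; proj₂)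
open import Data.Product.Properties using (≡-dec)
open import Data.Sum using (_⊎_; inj₁; inj₂)
import Data.Sum as Sum
open import Data.Unit using (⊤; tt)
open import Function using (id; _∘_; _on_)
open import Function.Bundles using (mk⇔)
open import Induction.WellFounded using (Acc; acc)
open import Relation.Binary.Construct.On using () renaming (wellFounded to on-wellFounded)
open import Relation.Binary.Definitions using (DecidableEquality)
open import Relation.Binary.PropositionalEquality
open import Relation.Nullary using (Dec; yes; no; ¬?)
open import Relation.Unary using (Decidable)
open import Relation.Nullary.Decidable using (_×-dec_; _⊎-dec_)

module _ {A : Set} where

  InjectiveOn : {B : Set} → (A → B) → List A → Set
  InjectiveOn f xs = ∀ {a b} → a ∈ xs → b ∈ xs → f a ≡ f b → a ≡ b

  unique-map⇒injectiveOn : {B : Set} (f : A → B) {xs : List A} →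
    Unique (map f xs) → InjectiveOn f xs
  unique-map⇒injectiveOn f (_ ∷ _) (here refl) (here refl) _ = refl
  unique-map⇒injectiveOn f (fx∉ ∷ _) (here refl) (there b∈) fa≡fb =
    ⊥-elim (All¬⇒¬Any fx∉ (subst (_∈ map f _) (sym fa≡fb) (∈-map⁺ f b∈)))
  unique-map⇒injectiveOn f (fx∉ ∷ _) (there a∈) (here refl) fa≡fb =
    ⊥-elim (All¬⇒¬Any fx∉ (subst (_∈ map f _) fa≡fb (∈-map⁺ f a∈)))
  unique-map⇒injectiveOn f (_ ∷ u) (there a∈) (there b∈) fa≡fb =
    unique-map⇒injectiveOn f u a∈ b∈ fa≡fb

  injectiveOn⇒unique-map : {B : Set} (f : A → B) {xs : List A} →
    Unique xs → InjectiveOn f xs → Unique (map f xs)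
  injectiveOn⇒unique-map f {[]} _ _ = []
  injectiveOn⇒unique-map f {x ∷ xs} (x∉ ∷ u) inj =
    All.tabulate fx∉ ∷ injectiveOn⇒unique-map f u (λ a∈ b∈ → inj (there a∈) (there b∈))
    where
    fx∉ : ∀ {y} → y ∈ map f xs → f x ≢ y
    fx∉ y∈ fx≡y with ∈-map⁻ f y∈
    ... | z , z∈ , refl = All¬⇒¬Any x∉ (subst (_∈ xs) (sym (inj (here refl) (there z∈) fx≡y)) z∈)

  unique-⊆⊇⇒↭ : {xs ys : List A} → Unique xs → Unique ys → xs ⊆ ys → ys ⊆ xs → xs ↭ ys
  unique-⊆⊇⇒↭ ux uy xs⊆ys ys⊆xs = ∼bag⇒↭ (unique∧set⇒bag ux uy (mk⇔ xs⊆ys ys⊆xs))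

  ∈-++-skip : ∀ {x y : A} ws {zs} → x ∈ ws ++ y ∷ zs → x ≢ y → x ∈ ws ++ zs
  ∈-++-skip []       (here x≡y) x≢y = ⊥-elim (x≢y x≡y)
  ∈-++-skip []       (there x∈) _   = x∈
  ∈-++-skip (w ∷ ws) (here x≡w) _   = here x≡w
  ∈-++-skip (w ∷ ws) (there x∈) x≢y = there (∈-++-skip ws x∈ x≢y)

  sum-map-mono-⊆ : (f : A → ℕ) {xs ys : List A} → Unique ys → ys ⊆ xs →
    sum (map f ys) ≤ sum (map f xs)
  sum-map-mono-⊆ f {ys = []} _ _ = z≤n
  sum-map-mono-⊆ f {ys = y ∷ ys} (y∉ ∷ u) ys⊆xs with ∈-∃++ (ys⊆xs (here refl))
  ... | ws , zs , refl = begin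
    f y + sum (map f ys)          ≤⟨ +-monoʳ-≤ (f y) (sum-map-mono-⊆ f u ys⊆ws++zs) ⟩
    f y + sum (map f (ws ++ zs))  ≡⟨ sum-↭ (↭.map⁺ f (↭-sym (↭.shift y ws zs))) ⟩
    sum (map f (ws ++ y ∷ zs))    ∎
    where
    open ≤-Reasoning
    ys⊆ws++zs : ys ⊆ ws ++ zs
    ys⊆ws++zs z∈ = ∈-++-skip ws (ys⊆xs (there z∈)) λ { refl → All¬⇒¬Any y∉ z∈ }

  length-mono-⊆ : {xs ys : List A} → Unique ys → ys ⊆ xs → length ys ≤ length xs
  length-mono-⊆ {xs} {ys} u ys⊆xs =
    subst₂ _≤_ (length≡sum ys) (length≡sum xs) (sum-map-mono-⊆ (λ _ → 1) u ys⊆xs)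
    where
    length≡sum : ∀ zs → sum (map (λ _ → 1) zs) ≡ length zs
    length≡sum []       = refl
    length≡sum (_ ∷ zs) = cong suc (length≡sum zs)

  ∈⇒≤sum : (f : A → ℕ) {xs : List A} {a : A} → a ∈ xs → f a ≤ sum (map f xs)
  ∈⇒≤sum f {xs} {a} a∈ = subst (_≤ sum (map f xs)) (+-identityʳ (f a))
    (sum-map-mono-⊆ f ([] ∷ []) λ { (here refl) → a∈ })

  sum-pair≤ : (f : A → ℕ) {xs : List A} {a b : A} → a ∈ xs → b ∈ xs → a ≢ b →
    f a + f b ≤ sum (map f xs)
  sum-pair≤ f {xs} {a} {b} a∈ b∈ a≢b = subst (_≤ sum (map f xs)) (cong (f a +_) (+-identityʳ (f b)))
    (sum-map-mono-⊆ f ((a≢b ∷ []) ∷ [] ∷ []) λ { (here refl) → a∈ ; (there (here refl)) → b∈ })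

  three-positive⇒3≤sum : (f : A → ℕ) {xs : List A} {a b c : A} →
    a ∈ xs → b ∈ xs → c ∈ xs → a ≢ b → a ≢ c → b ≢ c →
    0 < f a → 0 < f b → 0 < f c → 3 ≤ sum (map f xs)
  three-positive⇒3≤sum f a∈ b∈ c∈ a≢b a≢c b≢c fa fb fc = ≤-trans
    (+-mono-≤ fa (+-mono-≤ fb (+-mono-≤ fc z≤n)))
    (sum-map-mono-⊆ f ((a≢b ∷ a≢c ∷ []) ∷ (b≢c ∷ []) ∷ [] ∷ [])
      λ { (here refl) → a∈ ; (there (here refl)) → b∈ ; (there (there (here refl))) → c∈ })

  module _ (_≟_ : DecidableEquality A) where

    open import Data.List.Membership.DecPropositional _≟_ using (_∈?_)

    unique-⊆-length⇒⊇ : {xs ys : List A} → Unique ys → ys ⊆ xs →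
      length xs ≤ length ys → xs ⊆ ys
    unique-⊆-length⇒⊇ {xs} {ys} u ys⊆xs len {x} x∈xs with x ∈? ys
    ... | yes x∈ys = x∈ys
    ... | no  x∉ys = ⊥-elim (<⇒≱ (length-mono-⊆ (¬Any⇒All¬ ys x∉ys ∷ u) x∷ys⊆xs) len)
      where
      x∷ys⊆xs : x ∷ ys ⊆ xs
      x∷ys⊆xs (here refl) = x∈xs
      x∷ys⊆xs (there y∈)  = ys⊆xs y∈

  sum-positive : (f : A → ℕ) (xs : List A) → 0 < sum (map f xs) → ∃[ b ] b ∈ xs × 0 < f b
  sum-positive f (x ∷ xs) sum>0 with f x in fx≡
  ... | suc _ = x , here refl , subst (0 <_) (sym fx≡) (s≤s z≤n)
  ... | zero  with sum-positive f xs sum>0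
  ...   | b , b∈ , fb>0 = b , there b∈ , fb>0

  other-positive : (f : A → ℕ) {xs : List A} {a : A} → Unique xs → a ∈ xs →
    f a < sum (map f xs) → ∃[ b ] b ∈ xs × b ≢ a × 0 < f b
  other-positive f {x ∷ xs} (x∉ ∷ _) (here refl) fx<sum
    with sum-positive f xs
           (+-cancelˡ-< (f x) 0 _ (subst (_< f x + sum (map f xs)) (sym (+-identityʳ (f x))) fx<sum))
  ... | b , b∈ , fb>0 = b , there b∈ , (λ { refl → All¬⇒¬Any x∉ b∈ }) , fb>0
  other-positive f {x ∷ xs} (x∉ ∷ u) (there a∈) fa<sum with f x in fx≡
  ... | suc _ = x , here refl , (λ { refl → All¬⇒¬Any x∉ a∈ }) , subst (0 <_) (sym fx≡) (s≤s z≤n)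
  ... | zero  with other-positive f u a∈ fa<sum
  ...   | b , b∈ , b≢a , fb>0 = b , there b∈ , b≢a , fb>0

  unique⇒lookup-injective : {xs : List A} → Unique xs → ∀ i j → lookup xs i ≡ lookup xs j → i ≡ j
  unique⇒lookup-injective {x ∷ xs} u Fin.zero Fin.zero _ = refl
  unique⇒lookup-injective {x ∷ xs} (x∉ ∷ _) Fin.zero (Fin.suc j) x≡ =
    ⊥-elim (All¬⇒¬Any x∉ (subst (_∈ xs) (sym x≡) (∈-lookup j)))
  unique⇒lookup-injective {x ∷ xs} (x∉ ∷ _) (Fin.suc i) Fin.zero ≡x =
    ⊥-elim (All¬⇒¬Any x∉ (subst (_∈ xs) ≡x (∈-lookup i)))
  unique⇒lookup-injective {x ∷ xs} (_ ∷ u) (Fin.suc i) (Fin.suc j) eq =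
    cong Fin.suc (unique⇒lookup-injective u i j eq)

-- A union of two perfect matchings is bipartite

module _ {A : Set} (_≟_ : DecidableEquality A) where

  update : {B : Set} → (A → B) → A → B → A → B
  update f x v y with y ≟ x
  ... | yes _ = v
  ... | no  _ = f y

  update-≡ : {B : Set} (f : A → B) (x : A) (v : B) → update f x v x ≡ v
  update-≡ f x v with x ≟ x
  ... | yes _   = refl
  ... | no  x≢x = ⊥-elim (x≢x refl)

  update-≢ : {B : Set} (f : A → B) (x : A) (v : B) {y : A} → y ≢ x → update f x v y ≡ f y
  update-≢ f x v {y} y≢x with y ≟ x
  ... | yes y≡x = ⊥-elim (y≢x y≡x)
  ... | no  _   = refl

  record IsPerfectMatchingOn (p : A → A) (D : List A) : Set where
    field
      closed        : ∀ {a} → a ∈ D → p a ∈ D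
      involutive    : ∀ {a} → a ∈ D → p (p a) ≡ a
      fixpoint-free : ∀ {a} → a ∈ D → p a ≢ a

  Separates : (A → Bool) → (A → A) → List A → Set
  Separates col p D = ∀ {a} → a ∈ D → col (p a) ≢ col a

  TwoColouring : (A → A) → (A → A) → List A → Set
  TwoColouring r p D = Σ (A → Bool) λ col → Separates col r D × Separates col p D

  _∖[_,_] : List A → A → A → List A
  D ∖[ d , a ] = filter (λ y → ¬? (y ≟ d) ×-dec ¬? (y ≟ a)) D

  ∈-∖⁺ : ∀ {D d a y} → y ∈ D → y ≢ d → y ≢ a → y ∈ D ∖[ d , a ]
  ∈-∖⁺ y∈D y≢d y≢a = ∈-filter⁺ _ y∈D (y≢d , y≢a)

  ∈-∖⁻ : ∀ {D d a y} → y ∈ D ∖[ d , a ] → y ∈ D × y ≢ d × y ≢ a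
  ∈-∖⁻ {D} = ∈-filter⁻ _ {xs = D}

  ∖-shorter : ∀ {D d a} → d ∈ D → length (D ∖[ d , a ]) < length D
  ∖-shorter {D} d∈D = filter-notAll _ D (Any.map (λ { refl (d≢d , _) → d≢d refl }) d∈D)

  -- Removing the r-edge {d, a} leaves two perfect matchings on fewer points: either p also joins
  -- d and a, or the path p d – d – a – p a is contracted to a single p-edge.
  module Contraction {r p : A → A} {D : List A} {d : A} (d∈D : d ∈ D)
    (R : IsPerfectMatchingOn r D) (P : IsPerfectMatchingOn p D) where

    open IsPerfectMatchingOn

    a b c : A
    a = r d
    b = p d
    c = p a

    D′ : List A
    D′ = D ∖[ d , a ]

    a∈D : a ∈ D
    a∈D = closed R d∈D

    a≢d : a ≢ d
    a≢d = fixpoint-free R d∈D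

    ∈-D′⁻ : ∀ {y} → y ∈ D′ → y ∈ D × y ≢ d × y ≢ a
    ∈-D′⁻ = ∈-∖⁻ {D}

    restrict : ∀ {f} → IsPerfectMatchingOn f D → f d ≡ a → IsPerfectMatchingOn f D′
    restrict {f} F fd≡a = record
      { closed        = λ y∈ → let y∈D , y≢d , y≢a = ∈-D′⁻ y∈ in
          ∈-∖⁺ (closed F y∈D)
            (λ fy≡d → y≢a (trans (sym (involutive F y∈D)) (trans (cong f fy≡d) fd≡a)))
            (λ fy≡a → y≢d (trans (sym (involutive F y∈D)) (trans (cong f fy≡a) fa≡d)))
      ; involutive    = λ y∈ → involutive F (proj₁ (∈-D′⁻ y∈))
      ; fixpoint-free = λ y∈ → fixpoint-free F (proj₁ (∈-D′⁻ y∈))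
      }
      where
      fa≡d : f a ≡ d
      fa≡d = trans (cong f (sym fd≡a)) (involutive F d∈D)

    recolour : (A → Bool) → Bool → Bool → A → Bool
    recolour col′ vd va = update (update col′ a va) d vd

    module _ {col′ : A → Bool} {vd va : Bool} where

      recolour-d : recolour col′ vd va d ≡ vd
      recolour-d = update-≡ _ d vd

      recolour-a : recolour col′ vd va a ≡ va
      recolour-a = trans (update-≢ _ d vd a≢d) (update-≡ col′ a va)

      recolour-D′ : ∀ {y} → y ∈ D′ → recolour col′ vd va y ≡ col′ y
      recolour-D′ y∈ = let _ , y≢d , y≢a = ∈-D′⁻ y∈ in
        trans (update-≢ _ d vd y≢d) (update-≢ col′ a va y≢a)

      -- Every f-edge of D either lies in D′ or meets {d, a}.
      separates-recolour : ∀ {f f′} → IsPerfectMatchingOn f D → Separates col′ f′ D′ →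
        (∀ {y} → y ∈ D′ → f y ∈ D′ → f′ y ≡ f y) →
        let col = recolour col′ vd va in
        col (f d) ≢ col d → col (f a) ≢ col a → Separates col f D
      separates-recolour {f} {f′} F sep′ f′≡f at-d at-a {z} z∈D =
        cases (z ≟ d) (z ≟ a) (f z ≟ d) (f z ≟ a)
        where
        open ≡-Reasoning
        col : A → Bool
        col = recolour col′ vd va
        cases : Dec (z ≡ d) → Dec (z ≡ a) → Dec (f z ≡ d) → Dec (f z ≡ a) → col (f z) ≢ col z
        cases (yes refl) _          _ _ = at-d
        cases (no _)     (yes refl) _ _ = at-a
        cases (no _) (no _) (yes fz≡d) _ eq = at-d (begin
          col (f d)      ≡⟨ cong (col ∘ f) fz≡d ⟨
          col (f (f z))  ≡⟨ cong col (involutive F z∈D) ⟩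
          col z          ≡⟨ eq ⟨
          col (f z)      ≡⟨ cong col fz≡d ⟩
          col d          ∎)
        cases (no _) (no _) (no _) (yes fz≡a) eq = at-a (begin
          col (f a)      ≡⟨ cong (col ∘ f) fz≡a ⟨
          col (f (f z))  ≡⟨ cong col (involutive F z∈D) ⟩
          col z          ≡⟨ eq ⟨
          col (f z)      ≡⟨ cong col fz≡a ⟩
          col a          ∎)
        cases (no z≢d) (no z≢a) (no fz≢d) (no fz≢a) eq = sep′ z∈D′ (begin
          col′ (f′ z) ≡⟨ cong col′ (f′≡f z∈D′ fz∈D′) ⟩
          col′ (f z)  ≡⟨ recolour-D′ fz∈D′ ⟨
          col (f z)   ≡⟨ eq ⟩
          col z       ≡⟨ recolour-D′ z∈D′ ⟩
          col′ z      ∎)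
          where
          z∈D′ : z ∈ D′
          z∈D′ = ∈-∖⁺ z∈D z≢d z≢a
          fz∈D′ : f z ∈ D′
          fz∈D′ = ∈-∖⁺ (closed F z∈D) fz≢d fz≢a

    r-restricted : IsPerfectMatchingOn r D′
    r-restricted = restrict R refl

    module TwoCycle (pd≡a : p d ≡ a) where

      p-restricted : IsPerfectMatchingOn p D′
      p-restricted = restrict P pd≡a

      extend : TwoColouring r p D′ → TwoColouring r p D
      extend (col′ , sepr , sepp) = col
        , separates-recolour R sepr (λ _ _ → refl) a≢d-col (d≢a-col (involutive R d∈D))
        , separates-recolour P sepp (λ _ _ → refl)
            (subst (λ x → col x ≢ col d) (sym pd≡a) a≢d-col) (d≢a-col pa≡d)
        where
        col : A → Bool
        col = recolour col′ true false
        pa≡d : p a ≡ d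
        pa≡d = trans (cong p (sym pd≡a)) (involutive P d∈D)
        a≢d-col : col a ≢ col d
        a≢d-col eq with trans (sym recolour-a) (trans eq recolour-d)
        ... | ()
        d≢a-col : ∀ {x} → x ≡ d → col x ≢ col a
        d≢a-col refl eq with trans (sym recolour-d) (trans eq recolour-a)
        ... | ()

    module Contracted (pd≢a : p d ≢ a) where

      p′ : A → A
      p′ = update (update p c b) b c

      b∈D : b ∈ D
      b∈D = closed P d∈D

      c∈D : c ∈ D
      c∈D = closed P a∈D

      pb≡d : p b ≡ d
      pb≡d = involutive P d∈D

      pc≡a : p c ≡ a
      pc≡a = involutive P a∈D

      b≢c : b ≢ c
      b≢c b≡c = a≢d (trans (sym pc≡a) (trans (cong p (sym b≡c)) pb≡d))

      b∈D′ : b ∈ D′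
      b∈D′ = ∈-∖⁺ b∈D (fixpoint-free P d∈D) pd≢a

      c∈D′ : c ∈ D′
      c∈D′ = ∈-∖⁺ c∈D (λ c≡d → pd≢a (trans (cong p (sym c≡d)) pc≡a)) (fixpoint-free P a∈D)

      p′-b : p′ b ≡ c
      p′-b = update-≡ _ b c

      p′-c : p′ c ≡ b
      p′-c = trans (update-≢ _ b c (b≢c ∘ sym)) (update-≡ p c b)

      p′-other : ∀ {y} → y ≢ b → y ≢ c → p′ y ≡ p y
      p′-other y≢b y≢c = trans (update-≢ _ b c y≢b) (update-≢ p c b y≢c)

      p≢b : ∀ {y} → y ∈ D′ → p y ≢ b
      p≢b y∈ py≡b = proj₁ (proj₂ (∈-D′⁻ y∈))
        (trans (sym (involutive P (proj₁ (∈-D′⁻ y∈)))) (trans (cong p py≡b) pb≡d))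

      p≢c : ∀ {y} → y ∈ D′ → p y ≢ c
      p≢c y∈ py≡c = proj₂ (proj₂ (∈-D′⁻ y∈))
        (trans (sym (involutive P (proj₁ (∈-D′⁻ y∈)))) (trans (cong p py≡c) pc≡a))

      by-cases : (Q : A → Set) → Q b → Q c → (∀ {y} → y ∈ D′ → y ≢ b → y ≢ c → Q y) →
        ∀ {y} → y ∈ D′ → Q y
      by-cases Q Qb Qc Qy {y} y∈ = cases (y ≟ b) (y ≟ c)
        where
        cases : Dec (y ≡ b) → Dec (y ≡ c) → Q y
        cases (yes refl) _          = Qb
        cases (no _)     (yes refl) = Qc
        cases (no y≢b)   (no y≢c)   = Qy y∈ y≢b y≢c

      p′-matching : IsPerfectMatchingOn p′ D′
      p′-matching = record
        { closed = by-cases (λ y → p′ y ∈ D′)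
            (subst (_∈ D′) (sym p′-b) c∈D′)
            (subst (_∈ D′) (sym p′-c) b∈D′)
            (λ y∈ y≢b y≢c → subst (_∈ D′) (sym (p′-other y≢b y≢c)) (p-D′ y∈ y≢b y≢c))
        ; involutive = by-cases (λ y → p′ (p′ y) ≡ y)
            (trans (cong p′ p′-b) p′-c)
            (trans (cong p′ p′-c) p′-b)
            (λ y∈ y≢b y≢c → trans (cong p′ (p′-other y≢b y≢c))
              (trans (p′-other (p≢b y∈) (p≢c y∈)) (involutive P (proj₁ (∈-D′⁻ y∈)))))
        ; fixpoint-free = by-cases (λ y → p′ y ≢ y)
            (λ eq → b≢c (sym (trans (sym p′-b) eq)))
            (λ eq → b≢c (trans (sym p′-c) eq))
            (λ y∈ y≢b y≢c eq → fixpoint-free P (proj₁ (∈-D′⁻ y∈)) (trans (sym (p′-other y≢b y≢c)) eq))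
        }
        where
        p-D′ : ∀ {y} → y ∈ D′ → y ≢ b → y ≢ c → p y ∈ D′
        p-D′ y∈ y≢b y≢c = let y∈D , _ = ∈-D′⁻ y∈ in
          ∈-∖⁺ (closed P y∈D)
            (λ py≡d → y≢b (trans (sym (involutive P y∈D)) (cong p py≡d)))
            (λ py≡a → y≢c (trans (sym (involutive P y∈D)) (cong p py≡a)))

      extend : TwoColouring r p′ D′ → TwoColouring r p D
      extend (col′ , sepr , sepp′) = col
        , separates-recolour R sepr (λ _ _ → refl)
            (λ eq → col′b≢col′c (sym (not-injective (trans (sym recolour-a) (trans eq recolour-d)))))
            (λ eq → col′b≢col′c (not-injective (trans (sym recolour-d)
              (trans (trans (cong col (sym (involutive R d∈D))) eq) recolour-a))))
        , separates-recolour P sepp′ p′≡p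
            (λ eq → not-¬ refl (trans (sym (recolour-D′ b∈D′)) (trans eq recolour-d)))
            (λ eq → not-¬ refl (trans (sym (recolour-D′ c∈D′)) (trans eq recolour-a)))
        where
        col : A → Bool
        col = recolour col′ (not (col′ b)) (not (col′ c))
        col′b≢col′c : col′ b ≢ col′ c
        col′b≢col′c eq = sepp′ b∈D′ (trans (cong col′ p′-b) (sym eq))
        p′≡p : ∀ {y} → y ∈ D′ → p y ∈ D′ → p′ y ≡ p y
        p′≡p {y} y∈ py∈ = let _ , py≢d , py≢a = ∈-D′⁻ py∈ in p′-other
          (λ y≡b → py≢d (trans (cong p y≡b) pb≡d))
          (λ y≡c → py≢a (trans (cong p y≡c) pc≡a))

    extend : (∀ {q} → IsPerfectMatchingOn r D′ → IsPerfectMatchingOn q D′ → TwoColouring r q D′) →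
      TwoColouring r p D
    extend colour′ with p d ≟ a
    ... | yes pd≡a = TwoCycle.extend pd≡a (colour′ r-restricted (TwoCycle.p-restricted pd≡a))
    ... | no  pd≢a = Contracted.extend pd≢a (colour′ r-restricted (Contracted.p′-matching pd≢a))

  twoColouring-acc : ∀ {r} D → Acc (_<_ on length) D → ∀ {p} →
    IsPerfectMatchingOn r D → IsPerfectMatchingOn p D → TwoColouring r p D
  twoColouring-acc []      _         _ _ = (λ _ → true) , (λ ()) , (λ ())
  twoColouring-acc (d ∷ D) (acc rec) R P =
    extend λ R′ Q′ → twoColouring-acc _ (rec (∖-shorter {d ∷ D} (here refl))) R′ Q′
    where open Contraction (here refl) R P

  twoColouring : ∀ {r p} D → IsPerfectMatchingOn r D → IsPerfectMatchingOn p D → TwoColouring r p D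
  twoColouring D = twoColouring-acc D (on-wellFounded length <-wellFounded D)

concatMap-body : {A B : Set} {l : List B} (xs : List A) (F : A → List B) →
  l ≡ concatMap F xs → A → List B
concatMap-body _ F _ = F

concatMap-filter-cartesianProduct : {A B C : Set} {P : A × B → Set} (P? : Decidable P)
  (f : A × B → C) (xs : List A) (ys : List B) →
  concatMap (λ x → map f (filter P? (map (x ,_) ys))) xs ≡ map f (filter P? (cartesianProduct xs ys))
concatMap-filter-cartesianProduct P? f []       ys = refl
concatMap-filter-cartesianProduct P? f (x ∷ xs) ys = begin
  map f (filter P? (map (x ,_) ys)) ++ concatMap (λ x → map f (filter P? (map (x ,_) ys))) xs
    ≡⟨ cong (map f (filter P? (map (x ,_) ys)) ++_) (concatMap-filter-cartesianProduct P? f xs ys) ⟩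
  map f (filter P? (map (x ,_) ys)) ++ map f (filter P? (cartesianProduct xs ys))
    ≡⟨ map-++ f (filter P? (map (x ,_) ys)) _ ⟨
  map f (filter P? (map (x ,_) ys) ++ filter P? (cartesianProduct xs ys))
    ≡⟨ cong (map f) (filter-++ P? (map (x ,_) ys) _) ⟨
  map f (filter P? (map (x ,_) ys ++ cartesianProduct xs ys))
    ∎
  where open ≡-Reasoning

module Darts {V : Set} (_≟_ : DecidableEquality V) (G : Graph V) where

  Dart : Set
  Dart = Fin (m G) × Bool

  _≟ᵈ_ : DecidableEquality Dart
  _≟ᵈ_ = ≡-dec Fin._≟_ _≟ᵇ_

  tail head : Dart → V
  tail (e , false) = proj₁ (ends G e)
  tail (e , true)  = proj₂ (ends G e)
  head (e , false) = proj₂ (ends G e)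
  head (e , true)  = proj₁ (ends G e)

  rev : Dart → Dart
  rev (e , b) = e , not b

  tail-rev : ∀ a → tail (rev a) ≡ head a
  tail-rev (e , false) = refl
  tail-rev (e , true)  = refl

  head-rev : ∀ a → head (rev a) ≡ tail a
  head-rev (e , false) = refl
  head-rev (e , true)  = refl

  rev-involutive : ∀ a → rev (rev a) ≡ a
  rev-involutive (e , false) = refl
  rev-involutive (e , true)  = refl

  rev-≢ : ∀ a → rev a ≢ a
  rev-≢ (e , false) ()
  rev-≢ (e , true)  ()

  bools : List Bool
  bools = false ∷ true ∷ []

  darts : List Dart
  darts = cartesianProduct (allFin (m G)) bools

  darts-unique : Unique darts
  darts-unique = cartesianProduct⁺ (allFin⁺ _) (((λ ()) ∷ []) ∷ [] ∷ [])

  ∈-darts : ∀ a → a ∈ darts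
  ∈-darts (e , false) = ∈-cartesianProduct⁺ (∈-allFin e) (here refl)
  ∈-darts (e , true)  = ∈-cartesianProduct⁺ (∈-allFin e) (there (here refl))

  out : V → List Dart
  out v = filter (λ a → tail a ≟ v) darts

  out-unique : ∀ v → Unique (out v)
  out-unique v = filter⁺ (λ a → tail a ≟ v) darts-unique

  ∈-out⁺ : ∀ {v} a → tail a ≡ v → a ∈ out v
  ∈-out⁺ a tail≡v = ∈-filter⁺ _ (∈-darts a) tail≡v

  ∈-out⁻ : ∀ {v a} → a ∈ out v → tail a ≡ v
  ∈-out⁻ a∈ = proj₂ (∈-filter⁻ _ {xs = darts} a∈)

  module _ (v : V) where

    private
      outAt : Fin (m G) → List Dart
      outAt e = filter (λ a → tail a ≟ v) (map (e ,_) bools)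

    -- `nbrs` and `incid` are concatenations of per-edge lists computed by a helper local to
    -- their definitions; `concatMap-body` names that helper by unifying with the unfolded definition.
    nbrs≡map-head-out : nbrs _≟_ G v ≡ map head (out v)
    nbrs≡map-head-out = trans (concatMap-cong per-edge (allFin (m G)))
      (concatMap-filter-cartesianProduct _ head (allFin (m G)) bools)
      where
      per-edge : ∀ e → concatMap-body (allFin _) _ (refl {x = nbrs _≟_ G v}) e ≡ map head (outAt e)
      per-edge e with proj₁ (ends G e) ≟ v
      ... | yes _ with proj₂ (ends G e) ≟ v
      ...   | yes _ = refl
      ...   | no _  = refl
      per-edge e | no _ with proj₂ (ends G e) ≟ v
      ...   | yes _ = refl
      ...   | no _  = refl

    incid≡map-edge-out : incid _≟_ G v ≡ map proj₁ (out v)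
    incid≡map-edge-out = trans (concatMap-cong per-edge (allFin (m G)))
      (concatMap-filter-cartesianProduct _ proj₁ (allFin (m G)) bools)
      where
      per-edge : ∀ e → concatMap-body (allFin _) _ (refl {x = incid _≟_ G v}) e ≡ map proj₁ (outAt e)
      per-edge e with proj₁ (ends G e) ≟ v
      ... | yes _ with proj₂ (ends G e) ≟ v
      ...   | yes _ = refl
      ...   | no _  = refl
      per-edge e | no _ with proj₂ (ends G e) ≟ v
      ...   | yes _ = refl
      ...   | no _  = refl

    degree≡length-out : degree _≟_ G v ≡ length (out v)
    degree≡length-out = trans (cong length incid≡map-edge-out) (length-map proj₁ (out v))

-- Orienting the darts that are paired at their tails by a key

module Pairing {V : Set} (_≟_ : DecidableEquality V) (G : Graph V) {K : Set}
  (key : Fin (m G) → Maybe K) where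

  open Darts _≟_ G

  record Partner (a : Dart) (k : K) (b : Dart) : Set where
    field
      same-tail : tail b ≡ tail a
      distinct  : b ≢ a
      keyed     : key (proj₁ b) ≡ just k
      unique    : ∀ c → tail c ≡ tail a → c ≢ a → key (proj₁ c) ≡ just k → c ≡ b

  Paired : Set
  Paired = ∀ a k → key (proj₁ a) ≡ just k → Σ Dart (Partner a k)

  record IsOrientation (O : Dart → Bool) : Set where
    field
      rev-flips : ∀ a → O (rev a) ≡ not (O a)
      splits    : ∀ a b k → tail a ≡ tail b → a ≢ b →
                  key (proj₁ a) ≡ just k → key (proj₁ b) ≡ just k → O a ≢ O b

  module _ (paired : Paired) where

    open Partner

    partnerOf : ∀ a mk → key (proj₁ a) ≡ mk → Dart
    partnerOf a (just k) eq = proj₁ (paired a k eq)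
    partnerOf a nothing  _  = a

    partner : Dart → Dart
    partner a = partnerOf a (key (proj₁ a)) refl

    partnerOf-is : ∀ a mk (eq₀ : key (proj₁ a) ≡ mk) {k} → key (proj₁ a) ≡ just k →
      Partner a k (partnerOf a mk eq₀)
    partnerOf-is a nothing eq₀ eq with () ← trans (sym eq₀) eq
    partnerOf-is a (just k) eq₀ eq with refl ← just-injective (trans (sym eq₀) eq) =
      proj₂ (paired a k eq₀)

    partner-is : ∀ a {k} → key (proj₁ a) ≡ just k → Partner a k (partner a)
    partner-is a = partnerOf-is a _ refl

    Keyed : Dart → Set
    Keyed a = ∃[ k ] key (proj₁ a) ≡ just k

    keyed? : Decidable Keyed
    keyed? a with key (proj₁ a)
    ... | just k  = yes (k , refl)
    ... | nothing = no λ ()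

    keyedDarts : List Dart
    keyedDarts = filter keyed? darts

    ∈-keyed⁺ : ∀ {a} → Keyed a → a ∈ keyedDarts
    ∈-keyed⁺ = ∈-filter⁺ keyed? (∈-darts _)

    ∈-keyed⁻ : ∀ {a} → a ∈ keyedDarts → Keyed a
    ∈-keyed⁻ a∈ = proj₂ (∈-filter⁻ keyed? {xs = darts} a∈)

    rev-matching : IsPerfectMatchingOn _≟ᵈ_ rev keyedDarts
    rev-matching = record
      { closed        = λ a∈ → ∈-keyed⁺ (∈-keyed⁻ a∈)
      ; involutive    = λ {a} _ → rev-involutive a
      ; fixpoint-free = λ {a} _ → rev-≢ a
      }

    partner-matching : IsPerfectMatchingOn _≟ᵈ_ partner keyedDarts
    partner-matching = record
      { closed        = λ a∈ → let k , eq = ∈-keyed⁻ a∈ in ∈-keyed⁺ (k , keyed (partner-is _ eq))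
      ; involutive    = λ a∈ → let k , eq = ∈-keyed⁻ a∈ in involutive eq
      ; fixpoint-free = λ a∈ → let k , eq = ∈-keyed⁻ a∈ in distinct (partner-is _ eq)
      }
      where
      involutive : ∀ {a k} → key (proj₁ a) ≡ just k → partner (partner a) ≡ a
      involutive {a} eq = let b = partner-is a eq in
        sym (unique (partner-is (partner a) (keyed b)) a (sym (same-tail b)) (distinct b ∘ sym) eq)

    orientation : Σ (Dart → Bool) IsOrientation
    orientation with twoColouring _≟ᵈ_ keyedDarts rev-matching partner-matching
    ... | col , rev-separated , partner-separated =
      O , record { rev-flips = rev-flips ; splits = splits }
      where
      -- col is only constrained on keyed darts; O follows it on the stored direction of each edge
      -- so that reversal flips O everywhere.
      O : Dart → Bool
      O (e , false) = col (e , false)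
      O (e , true)  = not (col (e , false))

      rev-flips : ∀ a → O (rev a) ≡ not (O a)
      rev-flips (e , false) = refl
      rev-flips (e , true)  = sym (not-involutive _)

      O≡col : ∀ a → Keyed a → O a ≡ col a
      O≡col (e , false) _ = refl
      O≡col (e , true)  k = sym (¬-not (rev-separated (∈-keyed⁺ {e , false} k)))

      splits : ∀ a b k → tail a ≡ tail b → a ≢ b →
               key (proj₁ a) ≡ just k → key (proj₁ b) ≡ just k → O a ≢ O b
      splits a b k tail≡ a≢b ka kb Oa≡Ob = partner-separated (∈-keyed⁺ (k , ka)) (begin
        col (partner a)  ≡⟨ cong col (unique (partner-is a ka) b (sym tail≡) (a≢b ∘ sym) kb) ⟨
        col b            ≡⟨ O≡col b (k , kb) ⟨
        O b              ≡⟨ Oa≡Ob ⟨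
        O a              ≡⟨ O≡col a (k , ka) ⟩
        col a            ∎)
        where open ≡-Reasoning

module Rainbow {V : Set} (_≟_ : DecidableEquality V) (G : Graph V) (d : ℕ)
  (regular : ∀ v → degree _≟_ G v ≡ d) {Δ : ℕ} (Δ≡d : Δ ≡ d)
  (c : Fin (m G) → Fin Δ) (proper : ∀ v → Unique (map c (incid _≟_ G v))) where

  open Darts _≟_ G

  colour : Dart → ℕ
  colour a = toℕ (c (proj₁ a))

  colour<d : ∀ a → colour a < d
  colour<d a = subst (colour a <_) Δ≡d (toℕ<n _)

  colour-injective : ∀ v → InjectiveOn colour (out v)
  colour-injective v a∈ b∈ eq =
    unique-map⇒injectiveOn (c ∘ proj₁) unique-out a∈ b∈ (toℕ-injective eq)
    where
    unique-out : Unique (map (c ∘ proj₁) (out v))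
    unique-out = subst Unique (sym (map-∘ (out v)))
      (subst (Unique ∘ map c) (incid≡map-edge-out v) (proper v))

  -- Every vertex sees d distinct colours below d on its d darts, hence all of them.
  colour-exists : ∀ v k → k < d → ∃[ a ] tail a ≡ v × colour a ≡ k
  colour-exists v k k<d =
    let a , a∈ , k≡ = ∈-map⁻ colour (all-colours (∈-upTo⁺ k<d)) in a , ∈-out⁻ a∈ , sym k≡
    where
    colours-unique : Unique (map colour (out v))
    colours-unique = injectiveOn⇒unique-map colour (out-unique v) (colour-injective v)
    colours-below : map colour (out v) ⊆ upTo d
    colours-below k∈ with ∈-map⁻ colour k∈
    ... | a , _ , refl = ∈-upTo⁺ (colour<d a)
    all-colours : upTo d ⊆ map colour (out v)
    all-colours = unique-⊆-length⇒⊇ _≟ℕ_ colours-unique colours-below (≤-reflexive (begin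
      length (upTo d)              ≡⟨ length-upTo d ⟩
      d                            ≡⟨ regular v ⟨
      degree _≟_ G v               ≡⟨ degree≡length-out v ⟩
      length (out v)               ≡⟨ length-map colour (out v) ⟨
      length (map colour (out v))  ∎))
      where open ≡-Reasoning

  InPair : ℕ → ℕ → Dart → Set
  InPair i j a = colour a ≡ i ⊎ colour a ≡ j

  pairKey : ℕ → ℕ → Fin (m G) → Maybe ⊤
  pairKey i j e with (toℕ (c e) ≟ℕ i) ⊎-dec (toℕ (c e) ≟ℕ j)
  ... | yes _ = just tt
  ... | no  _ = nothing

  pairKey-just : ∀ {i j} a → InPair i j a → pairKey i j (proj₁ a) ≡ just tt
  pairKey-just {i} {j} a ij with (colour a ≟ℕ i) ⊎-dec (colour a ≟ℕ j)
  ... | yes _  = refl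
  ... | no ¬ij = ⊥-elim (¬ij ij)

  pairKey⇒InPair : ∀ {i j} a {k} → pairKey i j (proj₁ a) ≡ just k → InPair i j a
  pairKey⇒InPair {i} {j} a eq with (colour a ≟ℕ i) ⊎-dec (colour a ≟ℕ j)
  pairKey⇒InPair a refl | yes ij = ij

  module _ {i j : ℕ} (i<d : i < d) (j<d : j < d) (i≢j : i ≢ j) where

    open Pairing _≟_ G (pairKey i j)

    partner-of-colour : ∀ a {x y} → colour a ≡ x → y < d → x ≢ y → y ≡ i ⊎ y ≡ j →
      (∀ b → InPair i j b → colour b ≡ x ⊎ colour b ≡ y) → Σ Dart (Partner a tt)
    partner-of-colour a {x} {y} ax y<d x≢y y∈ij cover with colour-exists (tail a) y y<d
    ... | b , tb , by = b , record
      { same-tail = tb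
      ; distinct  = λ b≡a → x≢y (trans (sym ax) (trans (cong colour (sym b≡a)) by))
      ; keyed     = pairKey-just b (Sum.map (trans by) (trans by) y∈ij)
      ; unique    = λ c tc c≢a kc → unique-by c tc c≢a (cover c (pairKey⇒InPair c kc))
      }
      where
      unique-by : ∀ c → tail c ≡ tail a → c ≢ a → colour c ≡ x ⊎ colour c ≡ y → c ≡ b
      unique-by c tc c≢a (inj₁ cx) =
        ⊥-elim (c≢a (colour-injective (tail a) (∈-out⁺ c tc) (∈-out⁺ a refl) (trans cx (sym ax))))
      unique-by c tc c≢a (inj₂ cy) =
        colour-injective (tail a) (∈-out⁺ c tc) (∈-out⁺ b tb) (trans cy (sym by))

    paired : Paired
    paired a tt ka with pairKey⇒InPair a ka
    ... | inj₁ ai = partner-of-colour a ai j<d i≢j (inj₂ refl) (λ _ → id)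
    ... | inj₂ aj = partner-of-colour a aj i<d (i≢j ∘ sym) (inj₁ refl) (λ _ → Sum.swap)

  -- junk value `false` unless i, j < d and i ≢ j
  pairOrientation : ℕ → ℕ → Dart → Bool
  pairOrientation i j with i <? d | j <? d | i ≟ℕ j
  ... | yes i<d | yes j<d | no i≢j = proj₁ (Pairing.orientation _≟_ G (pairKey i j) (paired i<d j<d i≢j))
  ... | _       | _       | _      = λ _ → false

  module _ {i j : ℕ} (i<d : i < d) (j<d : j < d) (i≢j : i ≢ j) where

    private
      isOrientation : Pairing.IsOrientation _≟_ G (pairKey i j) (pairOrientation i j)
      isOrientation with i <? d | j <? d | i ≟ℕ j
      ... | yes _   | yes _   | no _    = proj₂ (Pairing.orientation _≟_ G (pairKey i j) _)
      ... | no ¬i<d | _       | _       = ⊥-elim (¬i<d i<d)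
      ... | yes _   | no ¬j<d | _       = ⊥-elim (¬j<d j<d)
      ... | yes _   | yes _   | yes i≡j = ⊥-elim (i≢j i≡j)

      module O = Pairing.IsOrientation isOrientation

    pairOrientation-rev : ∀ a → pairOrientation i j (rev a) ≡ not (pairOrientation i j a)
    pairOrientation-rev = O.rev-flips

    pairOrientation-splits : ∀ a b → tail a ≡ tail b → a ≢ b → InPair i j a → InPair i j b →
      pairOrientation i j a ≢ pairOrientation i j b
    pairOrientation-splits a b tail≡ a≢b ia ib =
      O.splits a b tt tail≡ a≢b (pairKey-just a ia) (pairKey-just b ib)

module SemiColoured {n : ℕ} (G : FGraph n) (sc : Fin (m G) → SemiColour G (maxDegree G))
  (semi : IsSemiColouring G sc) where

  open Darts Fin._≟_ G

  Δ : ℕ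
  Δ = maxDegree G

  pairOf : SemiColour G Δ → Maybe (Fin Δ × Fin Δ)
  pairOf (inj₁ _)        = nothing
  pairOf (inj₂ (ij , _)) = just ij

  key : Fin (m G) → Maybe (Fin Δ × Fin Δ)
  key = pairOf ∘ sc

  weight : Fin Δ → Dart → ℕ
  weight i a = weight2 G i (sc (proj₁ a))

  pairCount : Fin Δ → Fin Δ → Dart → ℕ
  pairCount i j a = isPair G i j (sc (proj₁ a))

  sum-incid : ∀ v (f : Fin (m G) → ℕ) →
    sum (map f (incid Fin._≟_ G v)) ≡ sum (map (f ∘ proj₁) (out v))
  sum-incid v f = cong sum (trans (cong (map f) (incid≡map-edge-out v)) (sym (map-∘ (out v))))

  weight≤2 : ∀ v i → sum (map (weight i) (out v)) ≤ 2
  weight≤2 v i = subst (_≤ 2) (sum-incid v _) (proj₁ (semi v) i)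

  pairCount-0∨2 : ∀ v {i j} → i Fin.< j →
    sum (map (pairCount i j) (out v)) ≡ 0 ⊎ sum (map (pairCount i j) (out v)) ≡ 2
  pairCount-0∨2 v {i} {j} i<j =
    Sum.map (trans (sym (sum-incid v _))) (trans (sym (sum-incid v _))) (proj₂ (semi v) i j i<j)

  isPair-own : ∀ (i j : Fin Δ) i<j → isPair G i j (inj₂ ((i , j) , i<j)) ≡ 1
  isPair-own i j _ with i Fin.≟ i | j Fin.≟ j
  ... | yes _   | yes _   = refl
  ... | no i≢i  | _       = ⊥-elim (i≢i refl)
  ... | yes _   | no j≢j  = ⊥-elim (j≢j refl)

  pairOf⇒isPair : ∀ (s : SemiColour G Δ) {i j} → pairOf s ≡ just (i , j) → isPair G i j s ≡ 1
  pairOf⇒isPair (inj₂ ((i , j) , i<j)) refl = isPair-own i j i<j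

  isPair⇒pairOf : ∀ (s : SemiColour G Δ) {i j} → 0 < isPair G i j s → pairOf s ≡ just (i , j)
  isPair⇒pairOf (inj₂ ((a , b) , _)) {i} {j} pos with i Fin.≟ a | j Fin.≟ b
  ... | yes refl | yes refl = refl

  weight-single : ∀ (i : Fin Δ) → weight2 G i (inj₁ i) ≡ 2
  weight-single i with i Fin.≟ i
  ... | yes _  = refl
  ... | no i≢i = ⊥-elim (i≢i refl)

  pairOf⇒weight : ∀ (s : SemiColour G Δ) {x i j} → pairOf s ≡ just (i , j) → x ≡ i ⊎ x ≡ j →
    0 < weight2 G x s
  pairOf⇒weight (inj₂ ((i , j) , _)) {x} refl x∈ij with x Fin.≟ i | x Fin.≟ j
  ... | yes _   | _       = s≤s z≤n
  ... | no _    | yes _   = s≤s z≤n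
  ... | no x≢i  | no x≢j  = ⊥-elim (Sum.[ x≢i , x≢j ] x∈ij)

  pairCount-own : ∀ a {i j : Fin Δ} {i<j} → sc (proj₁ a) ≡ inj₂ ((i , j) , i<j) → pairCount i j a ≡ 1
  pairCount-own a {i} {j} {i<j} sca = trans (cong (isPair G i j) sca) (isPair-own i j i<j)

  open Pairing Fin._≟_ G key

  -- The pair count 0-or-2 at the tail of a gives exactly one other dart with a's pair.
  paired : Paired
  paired a k ka with sc (proj₁ a) in sca
  paired a _ refl | inj₂ ((i , j) , i<j) with pairCount-0∨2 (tail a) i<j
  ... | inj₁ count≡0 = ⊥-elim (<-irrefl refl (subst (0 <_) count≡0 count≥1))
    where
    count≥1 : 0 < sum (map (pairCount i j) (out (tail a)))
    count≥1 = ≤-trans (≤-reflexive (sym (pairCount-own a sca))) (∈⇒≤sum (pairCount i j) (∈-out⁺ a refl))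
  ... | inj₂ count≡2 with other-positive (pairCount i j) (out-unique (tail a)) (∈-out⁺ a refl)
                            (subst₂ _<_ (sym (pairCount-own a sca)) (sym count≡2) (s≤s (s≤s z≤n)))
  ...   | b , b∈ , b≢a , pc-b = b , record
    { same-tail = ∈-out⁻ b∈
    ; distinct  = b≢a
    ; keyed     = isPair⇒pairOf (sc (proj₁ b)) pc-b
    ; unique    = unique
    }
    where
    unique : ∀ c → tail c ≡ tail a → c ≢ a → key (proj₁ c) ≡ just (i , j) → c ≡ b
    unique c tc c≢a kc with c ≟ᵈ b
    ... | yes c≡b = c≡b
    ... | no  c≢b = ⊥-elim (<-irrefl refl (≤-trans
      (three-positive⇒3≤sum (pairCount i j) (∈-out⁺ a refl) b∈ (∈-out⁺ c tc)
        (b≢a ∘ sym) (c≢a ∘ sym) (c≢b ∘ sym)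
        (≤-reflexive (sym (pairCount-own a sca))) pc-b
        (≤-reflexive (sym (pairOf⇒isPair (sc (proj₁ c)) kc))))
      (≤-reflexive count≡2)))

  pairOrientation : Dart → Bool
  pairOrientation = proj₁ (orientation paired)

  pairOrientation-is : IsOrientation pairOrientation
  pairOrientation-is = proj₂ (orientation paired)

-- The tight product

module Product {n₁ n₂ : ℕ} (d : ℕ) (G₁ : FGraph n₁) (G₂ : FGraph n₂)
  (regular₁ : Regular G₁ d) (regular₂ : Regular G₂ d)
  (Δ₁≡d : maxDegree G₁ ≡ d) (Δ₂≡d : maxDegree G₂ ≡ d)
  (sc : Fin (m G₁) → SemiColour G₁ (maxDegree G₁)) (semi : IsSemiColouring G₁ sc)
  (c : Fin (m G₂) → Fin (maxDegree G₂)) (proper : ProperEdgeColouring G₂ (maxDegree G₂) c) where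

  module D₁ = Darts Fin._≟_ G₁
  module D₂ = Darts Fin._≟_ G₂
  module S = SemiColoured G₁ sc semi
  module R = Rainbow Fin._≟_ G₂ d regular₂ Δ₂≡d c proper

  open Pairing.IsOrientation

  toℕ-≢ : ∀ {i j : Fin S.Δ} → i Fin.< j → toℕ i ≢ toℕ j
  toℕ-≢ i<j i≡j = <-irrefl i≡j i<j

  toℕ<d : (i : Fin S.Δ) → toℕ i < d
  toℕ<d i = subst (toℕ i <_) Δ₁≡d (toℕ<n i)

  colourFin : D₂.Dart → Fin S.Δ
  colourFin a₂ = Fin.fromℕ< (subst (R.colour a₂ <_) (sym Δ₁≡d) (R.colour<d a₂))

  toℕ-colourFin : ∀ a₂ → toℕ (colourFin a₂) ≡ R.colour a₂
  toℕ-colourFin a₂ = toℕ-fromℕ< _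

  colourFin-single : ∀ {a₂ i} → R.colour a₂ ≡ toℕ i → colourFin a₂ ≡ i
  colourFin-single {a₂} eq = toℕ-injective (trans (toℕ-colourFin a₂) eq)

  colourFin-pair : ∀ {a₂ i j} → R.InPair (toℕ i) (toℕ j) a₂ → colourFin a₂ ≡ i ⊎ colourFin a₂ ≡ j
  colourFin-pair {a₂} = Sum.map (colourFin-single {a₂}) (colourFin-single {a₂})

  orient₂ : Fin S.Δ → Fin S.Δ → D₂.Dart → Bool
  orient₂ i j = R.pairOrientation (toℕ i) (toℕ j)

  Fits : SemiColour G₁ S.Δ → D₁.Dart → D₂.Dart → Set
  Fits (inj₁ i)             a₁ a₂ = R.colour a₂ ≡ toℕ i
  Fits (inj₂ ((i , j) , _)) a₁ a₂ = R.InPair (toℕ i) (toℕ j) a₂ × S.pairOrientation a₁ ≡ orient₂ i j a₂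

  Compatible : D₁.Dart → D₂.Dart → Set
  Compatible a₁ a₂ = Fits (sc (proj₁ a₁)) a₁ a₂

  fits? : ∀ s a₁ a₂ → Dec (Fits s a₁ a₂)
  fits? (inj₁ i)             a₁ a₂ = R.colour a₂ ≟ℕ toℕ i
  fits? (inj₂ ((i , j) , _)) a₁ a₂ =
    ((R.colour a₂ ≟ℕ toℕ i) ⊎-dec (R.colour a₂ ≟ℕ toℕ j))
      ×-dec (S.pairOrientation a₁ ≟ᵇ orient₂ i j a₂)

  fits-rev : ∀ s a₁ a₂ → Fits s a₁ a₂ → Fits s (D₁.rev a₁) (D₂.rev a₂)
  fits-rev (inj₁ i)                a₁ a₂ fits         = fits
  fits-rev (inj₂ ((i , j) , i<j)) a₁ a₂ (ij , o₁≡o₂) = ij , (begin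
    S.pairOrientation (D₁.rev a₁)  ≡⟨ rev-flips S.pairOrientation-is a₁ ⟩
    not (S.pairOrientation a₁)     ≡⟨ cong not o₁≡o₂ ⟩
    not (orient₂ i j a₂)           ≡⟨ R.pairOrientation-rev (toℕ<d i) (toℕ<d j) (toℕ-≢ i<j) a₂ ⟨
    orient₂ i j (D₂.rev a₂)        ∎)
    where open ≡-Reasoning

  compatible-rev : ∀ a₁ a₂ → Compatible a₁ a₂ → Compatible (D₁.rev a₁) (D₂.rev a₂)
  compatible-rev (e , b) = fits-rev (sc e) (e , b)

  fits-exists : ∀ s a₁ x → ∃[ a₂ ] D₂.tail a₂ ≡ x × Fits s a₁ a₂
  fits-exists (inj₁ i) a₁ x = R.colour-exists x (toℕ i) (toℕ<d i)
  fits-exists (inj₂ ((i , j) , i<j)) a₁ x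
    with R.colour-exists x (toℕ i) (toℕ<d i) | R.colour-exists x (toℕ j) (toℕ<d j)
  ... | a , ta , ai | b , tb , bj with S.pairOrientation a₁ ≟ᵇ orient₂ i j a
  ...   | yes o≡a = a , ta , inj₁ ai , o≡a
  ...   | no  o≢a = b , tb , inj₂ bj , trans (¬-not o≢a) (sym (¬-not (split ∘ sym)))
    where
    split : orient₂ i j a ≢ orient₂ i j b
    split = R.pairOrientation-splits (toℕ<d i) (toℕ<d j) (toℕ-≢ i<j) a b (trans ta (sym tb))
      (λ a≡b → toℕ-≢ i<j (trans (sym ai) (trans (cong R.colour a≡b) bj))) (inj₁ ai) (inj₂ bj)

  compatible-exists : ∀ a₁ x → ∃[ a₂ ] D₂.tail a₂ ≡ x × Compatible a₁ a₂
  compatible-exists a₁ = fits-exists (sc (proj₁ a₁)) a₁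

  fits-unique : ∀ s a₁ {a₂ a₂′} → D₂.tail a₂ ≡ D₂.tail a₂′ → Fits s a₁ a₂ → Fits s a₁ a₂′ → a₂ ≡ a₂′
  fits-unique (inj₁ i) a₁ {a₂} {a₂′} t≡ ci ci′ =
    R.colour-injective _ (D₂.∈-out⁺ a₂ t≡) (D₂.∈-out⁺ a₂′ refl) (trans ci (sym ci′))
  fits-unique (inj₂ ((i , j) , i<j)) a₁ {a₂} {a₂′} t≡ (ij , o) (ij′ , o′) with a₂ D₂.≟ᵈ a₂′
  ... | yes a₂≡a₂′ = a₂≡a₂′
  ... | no  a₂≢a₂′ = ⊥-elim (R.pairOrientation-splits (toℕ<d i) (toℕ<d j) (toℕ-≢ i<j)
          a₂ a₂′ t≡ a₂≢a₂′ ij ij′ (trans (sym o) o′))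

  compatible-unique₂ : ∀ a₁ {a₂ a₂′} → D₂.tail a₂ ≡ D₂.tail a₂′ →
    Compatible a₁ a₂ → Compatible a₁ a₂′ → a₂ ≡ a₂′
  compatible-unique₂ a₁ = fits-unique (sc (proj₁ a₁)) a₁

  module Overweight {a₁ a₁′ : D₁.Dart} (a₂ : D₂.Dart)
    (t≡ : D₁.tail a₁ ≡ D₁.tail a₁′) (a₁≢a₁′ : a₁ ≢ a₁′) where

    open Pairing.Partner

    x : Fin S.Δ
    x = colourFin a₂

    W : D₁.Dart → ℕ
    W = S.weight x

    u : Fin n₁
    u = D₁.tail a₁

    a₁∈ : a₁ ∈ D₁.out u
    a₁∈ = D₁.∈-out⁺ a₁ refl

    a₁′∈ : a₁′ ∈ D₁.out u
    a₁′∈ = D₁.∈-out⁺ a₁′ (sym t≡)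

    weight-single : ∀ a {i} → sc (proj₁ a) ≡ inj₁ i → Fits (inj₁ i) a a₂ → W a ≡ 2
    weight-single a {i} e fits = trans (cong (weight2 G₁ x) e)
      (subst (λ y → weight2 G₁ y (inj₁ i) ≡ 2) (sym (colourFin-single {a₂} fits)) (S.weight-single i))

    weight-fits : ∀ a s → sc (proj₁ a) ≡ s → Fits s a a₂ → 0 < W a
    weight-fits a (inj₁ i)             e fits     = subst (0 <_) (sym (weight-single a e fits)) (s≤s z≤n)
    weight-fits a (inj₂ ((i , j) , _)) e (ij , _) =
      S.pairOf⇒weight (sc (proj₁ a)) (cong S.pairOf e) (colourFin-pair {a₂} ij)

    at-most-2 : W a₁ + W a₁′ ≤ 2
    at-most-2 = ≤-trans (sum-pair≤ W a₁∈ a₁′∈ a₁≢a₁′) (S.weight≤2 u x)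

    clash : ∀ s s′ → sc (proj₁ a₁) ≡ s → sc (proj₁ a₁′) ≡ s′ → Fits s a₁ a₂ → Fits s′ a₁′ a₂ → ⊥
    clash (inj₁ i) s′ e e′ f f′ = <-irrefl refl (≤-trans
      (+-mono-≤ (≤-reflexive (sym (weight-single a₁ e f))) (weight-fits a₁′ s′ e′ f′)) at-most-2)
    clash (inj₂ _) (inj₁ i′) e e′ f f′ = <-irrefl refl (≤-trans
      (+-mono-≤ (weight-fits a₁ _ e f) (≤-reflexive (sym (weight-single a₁′ e′ f′)))) at-most-2)
    clash (inj₂ ((i , j) , _)) (inj₂ ((i′ , j′) , _)) e e′ (ij , o) (ij′ , o′)
      with ≡-dec Fin._≟_ Fin._≟_ (i , j) (i′ , j′)
    ... | yes refl = splits S.pairOrientation-is a₁ a₁′ (i , j) t≡ a₁≢a₁′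
                       (cong S.pairOf e) (cong S.pairOf e′) (trans o (sym o′))
    -- a₁, its partner and a₁′ would each carry half of the colour of a₂
    ... | no  ij≢ij′ with S.paired a₁ (i , j) (cong S.pairOf e)
    ...   | b , partner = <-irrefl refl (≤-trans
      (three-positive⇒3≤sum W a₁∈ (D₁.∈-out⁺ b (same-tail partner)) a₁′∈
        (distinct partner ∘ sym) a₁≢a₁′ b≢a₁′
        (weight-fits a₁ _ e (ij , o))
        (S.pairOf⇒weight (sc (proj₁ b)) (keyed partner) (colourFin-pair {a₂} ij))
        (weight-fits a₁′ _ e′ (ij′ , o′)))
      (S.weight≤2 u x))
      where
      b≢a₁′ : b ≢ a₁′
      b≢a₁′ refl = ij≢ij′ (just-injective (trans (sym (keyed partner)) (cong S.pairOf e′)))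

  compatible-unique₁ : ∀ {a₁ a₁′} a₂ → D₁.tail a₁ ≡ D₁.tail a₁′ →
    Compatible a₁ a₂ → Compatible a₁′ a₂ → a₁ ≡ a₁′
  compatible-unique₁ {a₁} {a₁′} a₂ t≡ ca ca′ with a₁ D₁.≟ᵈ a₁′
  ... | yes a₁≡a₁′ = a₁≡a₁′
  ... | no  a₁≢a₁′ = ⊥-elim (Overweight.clash a₂ t≡ a₁≢a₁′ _ _ refl refl ca ca′)

  Vertex : Set
  Vertex = Fin n₁ × Fin n₂

  DartPair : Set
  DartPair = D₁.Dart × D₂.Dart

  tailᵖ headᵖ : DartPair → Vertex
  tailᵖ (a₁ , a₂) = D₁.tail a₁ , D₂.tail a₂
  headᵖ (a₁ , a₂) = D₁.head a₁ , D₂.head a₂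

  -- an edge of H is a G₁-edge in its stored direction together with a compatible G₂-dart
  Edge : Set
  Edge = Fin (m G₁) × D₂.Dart

  lift : Edge → Bool → DartPair
  lift (e , a₂) false = (e , false) , a₂
  lift (e , a₂) true  = (e , true) , D₂.rev a₂

  unlift : Bool → DartPair → Edge
  unlift false ((e , _) , a₂) = e , a₂
  unlift true  ((e , _) , a₂) = e , D₂.rev a₂

  unlift-lift : ∀ b p → unlift b (lift p b) ≡ p
  unlift-lift false p = refl
  unlift-lift true  (e , a₂) = cong (e ,_) (D₂.rev-involutive a₂)

  bit-lift : ∀ p b → proj₂ (proj₁ (lift p b)) ≡ b
  bit-lift p false = refl
  bit-lift p true  = refl

  compatible? : Decidable (λ (p : Edge) → Compatible (proj₁ p , false) (proj₂ p))
  compatible? (e , a₂) = fits? (sc e) (e , false) a₂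

  edges : List Edge
  edges = filter compatible? (cartesianProduct (allFin (m G₁)) D₂.darts)

  edges-unique : Unique edges
  edges-unique = filter⁺ compatible? (cartesianProduct⁺ (allFin⁺ _) D₂.darts-unique)

  H : Graph Vertex
  H = record
    { m    = length edges
    ; ends = λ i → tailᵖ (lift (lookup edges i) false) , headᵖ (lift (lookup edges i) false)
    }

  module DH = Darts (≡-dec Fin._≟_ Fin._≟_) H

  dart : DH.Dart → DartPair
  dart (i , b) = lift (lookup edges i) b

  tail-dart : ∀ h → DH.tail h ≡ tailᵖ (dart h)
  tail-dart (i , false) = refl
  tail-dart (i , true)  = let e , a₂ = lookup edges i in cong (D₁.head (e , false) ,_) (sym (D₂.tail-rev a₂))

  head-dart : ∀ h → DH.head h ≡ headᵖ (dart h)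
  head-dart (i , false) = refl
  head-dart (i , true)  = let e , a₂ = lookup edges i in cong (D₁.tail (e , false) ,_) (sym (D₂.head-rev a₂))

  lookup-compatible : ∀ i → let e , a₂ = lookup edges i in Compatible (e , false) a₂
  lookup-compatible i =
    proj₂ (∈-filter⁻ compatible? {xs = cartesianProduct (allFin (m G₁)) D₂.darts} (∈-lookup i))

  dart-compatible : ∀ h → Compatible (proj₁ (dart h)) (proj₂ (dart h))
  dart-compatible (i , false) = lookup-compatible i
  dart-compatible (i , true)  = compatible-rev _ _ (lookup-compatible i)

  dart-injective : ∀ h h′ → dart h ≡ dart h′ → h ≡ h′
  dart-injective (i , b) (j , b′) eq
    with refl ← trans (sym (bit-lift _ b)) (trans (cong (proj₂ ∘ proj₁) eq) (bit-lift _ b′)) =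
    cong (_, b) (unique⇒lookup-injective edges-unique i j
      (trans (sym (unlift-lift b _)) (trans (cong (unlift b) eq) (unlift-lift b _))))

  dart-surjective : ∀ a₁ a₂ → Compatible a₁ a₂ → ∃[ h ] dart h ≡ (a₁ , a₂)
  dart-surjective (e , b) a₂ compatible = (index p∈ , b) , (begin
    lift (lookup edges (index p∈)) b  ≡⟨ cong (λ p → lift p b) (lookup-index p∈) ⟨
    lift (unlift b ((e , b) , a₂)) b  ≡⟨ lift-unlift b ⟩
    (e , b) , a₂                       ∎)
    where
    open ≡-Reasoning
    lift-unlift : ∀ b → lift (unlift b ((e , b) , a₂)) b ≡ ((e , b) , a₂)
    lift-unlift false = refl
    lift-unlift true  = cong ((e , true) ,_) (D₂.rev-involutive a₂)
    forward : ∀ b → Compatible (e , b) a₂ →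
      let p = unlift b ((e , b) , a₂) in Compatible (proj₁ p , false) (proj₂ p)
    forward false c = c
    forward true  c = compatible-rev (e , true) a₂ c
    p∈ : unlift b ((e , b) , a₂) ∈ edges
    p∈ = ∈-filter⁺ compatible?
      (∈-cartesianProduct⁺ (∈-allFin _) (D₂.∈-darts _)) (forward b compatible)

  π₁ : DH.Dart → D₁.Dart
  π₁ = proj₁ ∘ dart

  π₂ : DH.Dart → D₂.Dart
  π₂ = proj₂ ∘ dart

  module AtVertex (u : Fin n₁) (x : Fin n₂) where

    w : Vertex
    w = u , x

    tail-at : ∀ {h} → h ∈ DH.out w → tailᵖ (dart h) ≡ w
    tail-at {h} h∈ = trans (sym (tail-dart h)) (DH.∈-out⁻ h∈)

    π₁-injective : InjectiveOn π₁ (DH.out w)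
    π₁-injective {h} {h′} h∈ h′∈ eq = dart-injective h h′ (cong₂ _,_ eq
      (compatible-unique₂ (π₁ h) (trans (cong proj₂ (tail-at h∈)) (sym (cong proj₂ (tail-at h′∈))))
        (dart-compatible h) (subst (λ a → Compatible a (π₂ h′)) (sym eq) (dart-compatible h′))))

    π₂-injective : InjectiveOn π₂ (DH.out w)
    π₂-injective {h} {h′} h∈ h′∈ eq = dart-injective h h′ (cong₂ _,_
      (compatible-unique₁ (π₂ h) (trans (cong proj₁ (tail-at h∈)) (sym (cong proj₁ (tail-at h′∈))))
        (dart-compatible h) (subst (Compatible (π₁ h′)) (sym eq) (dart-compatible h′)))
      eq)

    π₁-image : map π₁ (DH.out w) ⊆ D₁.out u
    π₁-image a∈ with ∈-map⁻ π₁ a∈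
    ... | h , h∈ , refl = D₁.∈-out⁺ (π₁ h) (cong proj₁ (tail-at h∈))

    π₂-image : map π₂ (DH.out w) ⊆ D₂.out x
    π₂-image a∈ with ∈-map⁻ π₂ a∈
    ... | h , h∈ , refl = D₂.∈-out⁺ (π₂ h) (cong proj₂ (tail-at h∈))

    π₁-onto : D₁.out u ⊆ map π₁ (DH.out w)
    π₁-onto {a₁} a₁∈ with compatible-exists a₁ x
    ... | a₂ , ta₂ , compatible with dart-surjective a₁ a₂ compatible
    ...   | h , dart≡ = subst (_∈ map π₁ (DH.out w)) (cong proj₁ dart≡) (∈-map⁺ π₁ (DH.∈-out⁺ h
            (trans (tail-dart h) (trans (cong tailᵖ dart≡) (cong₂ _,_ (D₁.∈-out⁻ a₁∈) ta₂)))))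

    π₁-↭ : map π₁ (DH.out w) ↭ D₁.out u
    π₁-↭ = unique-⊆⊇⇒↭ (injectiveOn⇒unique-map π₁ (DH.out-unique w) π₁-injective)
      (D₁.out-unique u) π₁-image π₁-onto

    -- π₂ is onto because both sides have d darts.
    π₂-↭ : map π₂ (DH.out w) ↭ D₂.out x
    π₂-↭ = unique-⊆⊇⇒↭ unique (D₂.out-unique x) π₂-image
      (unique-⊆-length⇒⊇ D₂._≟ᵈ_ unique π₂-image (≤-reflexive (begin
        length (D₂.out x)             ≡⟨ D₂.degree≡length-out x ⟨
        degree Fin._≟_ G₂ x           ≡⟨ regular₂ x ⟩
        d                             ≡⟨ regular₁ u ⟨
        degree Fin._≟_ G₁ u           ≡⟨ D₁.degree≡length-out u ⟩
        length (D₁.out u)             ≡⟨ ↭.↭-length π₁-↭ ⟨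
        length (map π₁ (DH.out w))    ≡⟨ length-map π₁ (DH.out w) ⟩
        length (DH.out w)             ≡⟨ length-map π₂ (DH.out w) ⟨
        length (map π₂ (DH.out w))    ∎)))
      where
      open ≡-Reasoning
      unique : Unique (map π₂ (DH.out w))
      unique = injectiveOn⇒unique-map π₂ (DH.out-unique w) π₂-injective

    nbrs-coordinate : {A W : Set} (proj : Vertex → W) (π : DH.Dart → A) (hd : A → W) →
      (∀ h → proj (DH.head h) ≡ hd (π h)) →
      map proj (nbrs (≡-dec Fin._≟_ Fin._≟_) H w) ≡ map hd (map π (DH.out w))
    nbrs-coordinate proj π hd proj-head = begin
      map proj (nbrs (≡-dec Fin._≟_ Fin._≟_) H w)  ≡⟨ cong (map proj) (DH.nbrs≡map-head-out w) ⟩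
      map proj (map DH.head (DH.out w))            ≡⟨ map-∘ (DH.out w) ⟨
      map (proj ∘ DH.head) (DH.out w)              ≡⟨ map-cong proj-head (DH.out w) ⟩
      map (hd ∘ π) (DH.out w)                      ≡⟨ map-∘ (DH.out w) ⟩
      map hd (map π (DH.out w))                    ∎
      where open ≡-Reasoning

    covering₁ : map proj₁ (nbrs (≡-dec Fin._≟_ Fin._≟_) H w) ↭ nbrs Fin._≟_ G₁ u
    covering₁ = subst₂ _↭_
      (sym (nbrs-coordinate proj₁ π₁ D₁.head (cong proj₁ ∘ head-dart)))
      (sym (D₁.nbrs≡map-head-out u))
      (↭.map⁺ D₁.head π₁-↭)

    covering₂ : map proj₂ (nbrs (≡-dec Fin._≟_ Fin._≟_) H w) ↭ nbrs Fin._≟_ G₂ x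
    covering₂ = subst₂ _↭_
      (sym (nbrs-coordinate proj₂ π₂ D₂.head (cong proj₂ ∘ head-dart)))
      (sym (D₂.nbrs≡map-head-out x))
      (↭.map⁺ D₂.head π₂-↭)

  tightProduct : TightProduct G₁ G₂
  tightProduct = H
    , (λ (u , x) → AtVertex.covering₁ u x)
    , (λ (u , x) → AtVertex.covering₂ u x)

regular⇒maxDegree≡ : ∀ {n} (G : FGraph (suc n)) {d} → Regular G d → maxDegree G ≡ d
regular⇒maxDegree≡ G {d} regular = max-const Fin.zero (tabulate Fin.suc)
  where
  max-const : ∀ v vs → foldr _⊔_ 0 (map (deg G) (v ∷ vs)) ≡ d
  max-const v []       = trans (⊔-identityʳ (deg G v)) (regular v)
  max-const v (v′ ∷ vs) = trans (cong₂ _⊔_ (regular v) (max-const v′ vs)) (⊔-idem d)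

proposition5 : (k n₁ n₂ : ℕ) (G₁ : FGraph n₁) (G₂ : FGraph n₂) →
    Regular G₁ (2 * k + 1) → Regular G₂ (2 * k + 1) →
    HasSemiColouring G₁ → Class1 G₂ → TightProduct G₁ G₂
proposition5 k zero n₂ G₁ G₂ _ _ _ _ =
  record { m = 0 ; ends = λ () } , (λ { (() , _) }) , (λ { (() , _) })
proposition5 k (suc n₁) zero G₁ G₂ _ _ _ _ =
  record { m = 0 ; ends = λ () } , (λ { (_ , ()) }) , (λ { (_ , ()) })
proposition5 k (suc n₁) (suc n₂) G₁ G₂ regular₁ regular₂ (sc , semi) ((c , proper) , _) =
  Product.tightProduct (2 * k + 1) G₁ G₂ regular₁ regular₂
    (regular⇒maxDegree≡ G₁ regular₁) (regular⇒maxDegree≡ G₂ regular₂) sc semi c proper
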